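{- Let $A$ be a set of $n$ integers and $k \in \{0,\dots,n-1\}$. Let $G$ be the bipartite graph with vertex classes $U=\{u_s : s\in k\wedge A\}$ and $V=\{v_t : t \in (k+1)\wedge A\}$, where $u_s v_t$ is an edge if and only if there exist distinct elements $a_1,\dots,a_{k+1}$ of $A$ with $s=a_1+\dots+a_k$ and $t=a_1+\dots+a_{k+1}$. Let $T\subseteq (k+1)\wedge A$ be the set of integers having at least two representations as a sum of $k+1$ distinct elements of $A$ (representations being different if the underlying $(k+1)$-element subsets of $A$ differ). Then every vertex $v_t$ with $t\in T$ has degree at least $k+3$ in $G$.
   Context: For a finite set $A \subseteq \mathbb{Z}$ and integer $j\ge 0$, $j\wedge A$ denotes the set of integers expressible as a sum of $j$ distinct elements of $A$. -}

module Defs where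

open import Data.Nat using (ℕ; suc; _+_)
open import Data.Integer using (ℤ) renaming (_+_ to _+ℤ_; +_ to pos)
open import Data.List using (List; length; foldr; take)
open import Data.List.Membership.Propositional using (_∈_)
open import Data.List.Relation.Unary.All using (All)
open import Data.List.Relation.Unary.Unique.Propositional using (Unique)
open import Data.Product using (Σ; _×_; ∃)
open import Function.Bundles using (_⇔_)
open import Relation.Binary.PropositionalEquality using (_≡_)
open import Relation.Nullary using (¬_)

sumℤ : List ℤ → ℤ
sumℤ = foldr _+ℤ_ (pos 0)

DistinctFrom : ℕ → List ℤ → List ℤ → Set
DistinctFrom j A as = length as ≡ j × Unique as × All (_∈ A) as

Rep : ℕ → List ℤ → ℤ → List ℤ → Set
Rep j A t as = DistinctFrom j A as × sumℤ as ≡ t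

InWedge : ℕ → List ℤ → ℤ → Set
InWedge j A t = Σ (List ℤ) (Rep j A t)

InT : ℕ → List ℤ → ℤ → Set
InT k A t = Σ (List ℤ) λ xs → Σ (List ℤ) λ ys →
  Rep (suc k) A t xs × Rep (suc k) A t ys × ¬ (∀ x → (x ∈ xs) ⇔ (x ∈ ys))

Edge : ℕ → List ℤ → ℤ → ℤ → Set
Edge k A s t = Σ (List ℤ) λ as →
  DistinctFrom (suc k) A as × sumℤ (take k as) ≡ s × sumℤ as ≡ t

Neighbour : ℕ → List ℤ → ℤ → ℤ → Set
Neighbour k A t s = InWedge k A s × Edge k A s t

DegreeAtLeast : ℕ → ℕ → List ℤ → ℤ → Set
DegreeAtLeast d k A t = Σ (List ℤ) λ ss →
  length ss ≡ d × Unique ss × All (Neighbour k A t) ss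

-- Let xs and ys be two representations of t with different underlying sets.
-- Removing any a ∈ xs ∪ ys from the representation containing it yields a
-- neighbour t − a of v_t, so it suffices to show |xs ∪ ys| ≥ k + 3, i.e. that
-- ys ∖ xs has at least two elements. The common part xs ∩ ys cancels, so
-- xs ∖ ys and ys ∖ xs are disjoint, of equal size and of equal sum; they are
-- nonempty since the sets differ, and they cannot both be singletons {x}, {y},
-- as x = y would then lie in both.
module Submission where

open import Defs
open import Data.Nat using (ℕ; suc; _+_; _<_; _≤_; s≤s; z≤n)
import Data.Nat.Properties as ℕP
open import Data.Integer using (ℤ; -_; _-_) renaming (_+_ to _+ℤ_)
import Data.Integer.Properties as ℤP
open import Algebra.Properties.AbelianGroup ℤP.+-0-abelianGroup using (∙-cancelˡ; x≈z//y)
open import Data.List using (List; []; _∷_; _++_; _∷ʳ_; length; map; filter; take)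
import Data.List.Properties as LP
open import Data.List.Membership.Propositional using (_∈_)
open import Data.List.Membership.Propositional.Properties
  using (∈-∃++; ∈-filter⁺; ∈-filter⁻; ∈-++⁻)
open import Data.List.Membership.Propositional.Properties.WithK using (unique∧set⇒bag)
open import Data.List.Membership.DecPropositional ℤP._≟_ using (_∈?_)
open import Data.List.Relation.Unary.All as All using (All; _∷_)
import Data.List.Relation.Unary.All.Properties as AllP
open import Data.List.Relation.Unary.AllPairs using (_∷_)
open import Data.List.Relation.Unary.Any using (here)
open import Data.List.Relation.Unary.Unique.Propositional using (Unique)
import Data.List.Relation.Unary.Unique.Propositional.Properties as UniqueP
open import Data.List.Relation.Binary.Disjoint.Propositional using (Disjoint)
open import Data.List.Relation.Binary.Subset.Propositional using (_⊆_)
open import Data.List.Relation.Binary.BagAndSetEquality using (∼bag⇒↭)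
open import Data.List.Relation.Binary.Permutation.Propositional
  using (_↭_; ↭-trans; ↭⇒↭ₛ; ↭ₛ⇒↭)
import Data.List.Relation.Binary.Permutation.Propositional.Properties as ↭P
import Data.List.Relation.Binary.Permutation.Setoid.Properties as ↭ₛP
open import Data.Product using (_×_; _,_; proj₁; proj₂)
open import Data.Sum as Sum using (_⊎_; inj₁; inj₂; [_,_]′)
open import Data.Empty using (⊥-elim)
open import Function.Bundles using (_⇔_; mk⇔)
open import Relation.Nullary using (¬_; yes; no)
open import Relation.Unary.Properties using (∁?)
open import Relation.Binary.PropositionalEquality
  using (_≡_; refl; sym; trans; cong; subst; setoid; module ≡-Reasoning)

private
  module ↭ℤ = ↭ₛP (setoid ℤ)

sumℤ-++ : ∀ xs ys → sumℤ (xs ++ ys) ≡ sumℤ xs +ℤ sumℤ ys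
sumℤ-++ []       ys = sym (ℤP.+-identityˡ (sumℤ ys))
sumℤ-++ (x ∷ xs) ys = trans (cong (x +ℤ_) (sumℤ-++ xs ys)) (sym (ℤP.+-assoc x _ _))

sumℤ-↭ : ∀ {xs ys} → xs ↭ ys → sumℤ xs ≡ sumℤ ys
sumℤ-↭ p = ↭ℤ.foldr-commMonoid ℤP.+-0-isCommutativeMonoid (↭⇒↭ₛ p)

Unique-resp-↭ : ∀ {xs ys : List ℤ} → xs ↭ ys → Unique xs → Unique ys
Unique-resp-↭ p = ↭ℤ.Unique-resp-↭ (↭⇒↭ₛ p)

take-length-++ : ∀ {a} {A : Set a} (xs ys : List A) → take (length xs) (xs ++ ys) ≡ xs
take-length-++ []       ys = refl
take-length-++ (x ∷ xs) ys = cong (x ∷_) (take-length-++ xs ys)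

-‿cancelˡ : ∀ t {a b} → t - a ≡ t - b → a ≡ b
-‿cancelˡ t {a} {b} eq = ℤP.neg-injective (∙-cancelˡ t (- a) (- b) eq)

Rep-resp-↭ : ∀ {j A t xs ys} → xs ↭ ys → Rep j A t xs → Rep j A t ys
Rep-resp-↭ p ((len , unique , ⊆A) , sum≡t) =
  (trans (sym (↭P.↭-length p)) len , Unique-resp-↭ p unique , ↭P.All-resp-↭ p ⊆A) ,
  trans (sym (sumℤ-↭ p)) sum≡t

Rep-∷⁻ : ∀ {j A t a ws} → Rep (suc j) A t (a ∷ ws) → Rep j A (t - a) ws
Rep-∷⁻ {a = a} {ws} ((len , _ ∷ unique , _ ∷ ⊆A) , a+sum≡t) =
  (ℕP.suc-injective len , unique , ⊆A) ,
  x≈z//y (sumℤ ws) a _ (trans (ℤP.+-comm (sumℤ ws) a) a+sum≡t)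

Rep-∷⇒Neighbour : ∀ {k A t a ws} → Rep (suc k) A t (a ∷ ws) → Neighbour k A t (t - a)
Rep-∷⇒Neighbour {k} {A} {t} {a} {ws} rep =
  (ws , rep-ws) , (ws ∷ʳ a , proj₁ rep-edge , sum-take-k , proj₂ rep-edge)
  where
  rep-ws : Rep k A (t - a) ws
  rep-ws = Rep-∷⁻ rep
  rep-edge : Rep (suc k) A t (ws ∷ʳ a)
  rep-edge = Rep-resp-↭ (↭P.∷↭∷ʳ a ws) rep
  sum-take-k : sumℤ (take k (ws ∷ʳ a)) ≡ t - a
  sum-take-k = begin
    sumℤ (take k (ws ∷ʳ a))            ≡⟨ cong (λ m → sumℤ (take m (ws ∷ʳ a))) (proj₁ (proj₁ rep-ws)) ⟨
    sumℤ (take (length ws) (ws ∷ʳ a))  ≡⟨ cong sumℤ (take-length-++ ws _) ⟩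
    sumℤ ws                            ≡⟨ proj₂ rep-ws ⟩
    t - a                              ∎
    where open ≡-Reasoning

Rep⇒Neighbour : ∀ {k A t xs a} → Rep (suc k) A t xs → a ∈ xs → Neighbour k A t (t - a)
Rep⇒Neighbour {a = a} rep a∈xs with ∈-∃++ a∈xs
... | us , vs , refl = Rep-∷⇒Neighbour (Rep-resp-↭ (↭P.shift a us vs) rep)

neighbours⇒DegreeAtLeast : ∀ {d k A t ss} → d ≤ length ss → Unique ss →
  All (Neighbour k A t) ss → DegreeAtLeast d k A t
neighbours⇒DegreeAtLeast {d} {ss = ss} d≤ unique neighbours =
  take d ss ,
  trans (LP.length-take d ss) (ℕP.m≤n⇒m⊓n≡m d≤) ,
  UniqueP.take⁺ d unique ,
  AllP.take⁺ d neighbours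

infixl 6 _∩_ _∖_

_∩_ _∖_ : List ℤ → List ℤ → List ℤ
xs ∩ ys = filter (_∈? ys) xs
xs ∖ ys = filter (∁? (_∈? ys)) xs

↭-∩-∖ : ∀ xs ys → xs ↭ xs ∩ ys ++ xs ∖ ys
↭-∩-∖ xs ys = subst (λ (ps : List ℤ × List ℤ) → xs ↭ proj₁ ps ++ proj₂ ps)
  (LP.partition-defn (_∈? ys) xs)
  (↭ₛ⇒↭ (↭ℤ.partition-↭ (_∈? ys) xs))

∩-comm-⊆ : ∀ xs ys → xs ∩ ys ⊆ ys ∩ xs
∩-comm-⊆ xs ys z∈ = let (z∈xs , z∈ys) = ∈-filter⁻ (_∈? ys) z∈ in ∈-filter⁺ (_∈? xs) z∈ys z∈xs

∩-↭ : ∀ {xs ys} → Unique xs → Unique ys → xs ∩ ys ↭ ys ∩ xs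
∩-↭ {xs} {ys} unique-xs unique-ys = ∼bag⇒↭ (unique∧set⇒bag
  (UniqueP.filter⁺ (_∈? ys) unique-xs) (UniqueP.filter⁺ (_∈? xs) unique-ys)
  (mk⇔ (∩-comm-⊆ xs ys) (∩-comm-⊆ ys xs)))

↭-∩-∖ʳ : ∀ {xs ys} → Unique xs → Unique ys → ys ↭ xs ∩ ys ++ ys ∖ xs
↭-∩-∖ʳ {xs} {ys} unique-xs unique-ys =
  ↭-trans (↭-∩-∖ ys xs) (↭P.++⁺ʳ (ys ∖ xs) (∩-↭ unique-ys unique-xs))

∈-∖⁻ : ∀ {z} xs ys → z ∈ xs ∖ ys → z ∈ xs × ¬ z ∈ ys
∈-∖⁻ xs ys = ∈-filter⁻ (∁? (_∈? ys)) {xs = xs}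

∖-disjoint : ∀ xs ys → Disjoint (xs ∖ ys) (ys ∖ xs)
∖-disjoint xs ys (z∈xs∖ys , z∈ys∖xs) = proj₂ (∈-∖⁻ xs ys z∈xs∖ys) (proj₁ (∈-∖⁻ ys xs z∈ys∖xs))

∖≡[]⇒⊆ : ∀ {xs ys} → xs ∖ ys ≡ [] → xs ⊆ ys
∖≡[]⇒⊆ {xs} {ys} xs∖ys≡[] {z} z∈xs with z ∈? ys
... | yes z∈ys = z∈ys
... | no z∉ys with subst (z ∈_) xs∖ys≡[] (∈-filter⁺ (∁? (_∈? ys)) z∈xs z∉ys)
...   | ()

Balanced : List ℤ → List ℤ → Set
Balanced ds es = length ds ≡ length es × sumℤ ds ≡ sumℤ es

∖-balanced : ∀ {xs ys} → Unique xs → Unique ys → Balanced xs ys → Balanced (xs ∖ ys) (ys ∖ xs)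
∖-balanced {xs} {ys} unique-xs unique-ys (len-xs≡len-ys , sum-xs≡sum-ys) =
  ℕP.+-cancelˡ-≡ (length common) _ _ length-eq , ∙-cancelˡ (sumℤ common) _ _ sum-eq
  where
  common : List ℤ
  common = xs ∩ ys
  xs↭ : xs ↭ common ++ xs ∖ ys
  xs↭ = ↭-∩-∖ xs ys
  ys↭ : ys ↭ common ++ ys ∖ xs
  ys↭ = ↭-∩-∖ʳ unique-xs unique-ys
  open ≡-Reasoning
  length-eq : length common + length (xs ∖ ys) ≡ length common + length (ys ∖ xs)
  length-eq = begin
    length common + length (xs ∖ ys)  ≡⟨ LP.length-++ common ⟨
    length (common ++ xs ∖ ys)        ≡⟨ ↭P.↭-length xs↭ ⟨
    length xs                         ≡⟨ len-xs≡len-ys ⟩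
    length ys                         ≡⟨ ↭P.↭-length ys↭ ⟩
    length (common ++ ys ∖ xs)        ≡⟨ LP.length-++ common ⟩
    length common + length (ys ∖ xs)  ∎
  sum-eq : sumℤ common +ℤ sumℤ (xs ∖ ys) ≡ sumℤ common +ℤ sumℤ (ys ∖ xs)
  sum-eq = begin
    sumℤ common +ℤ sumℤ (xs ∖ ys)  ≡⟨ sumℤ-++ common _ ⟨
    sumℤ (common ++ xs ∖ ys)       ≡⟨ sumℤ-↭ xs↭ ⟨
    sumℤ xs                        ≡⟨ sum-xs≡sum-ys ⟩
    sumℤ ys                        ≡⟨ sumℤ-↭ ys↭ ⟩
    sumℤ (common ++ ys ∖ xs)       ≡⟨ sumℤ-++ common _ ⟩
    sumℤ common +ℤ sumℤ (ys ∖ xs)  ∎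

balanced-disjoint⇒[]⊎2≤length : ∀ {ds es} → Balanced ds es → Disjoint ds es →
  (ds ≡ [] × es ≡ []) ⊎ 2 ≤ length es
balanced-disjoint⇒[]⊎2≤length {[]}        {[]}         _        _        = inj₁ (refl , refl)
balanced-disjoint⇒[]⊎2≤length {_}         {_ ∷ _ ∷ _}  _        _        = inj₂ (s≤s (s≤s z≤n))
balanced-disjoint⇒[]⊎2≤length {d ∷ []}    {e ∷ []}     (_ , eq) disjoint =
  ⊥-elim (disjoint (here refl , here d≡e))
  where
  d≡e : d ≡ e
  d≡e = trans (sym (ℤP.+-identityʳ d)) (trans eq (ℤP.+-identityʳ e))
balanced-disjoint⇒[]⊎2≤length {[]}        {_ ∷ []}     (() , _) _
balanced-disjoint⇒[]⊎2≤length {_ ∷ _}     {[]}         (() , _) _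
balanced-disjoint⇒[]⊎2≤length {_ ∷ _ ∷ _} {_ ∷ []}     (() , _) _

2≤length-∖ : ∀ {xs ys} → Unique xs → Unique ys → Balanced xs ys →
  ¬ (∀ z → (z ∈ xs) ⇔ (z ∈ ys)) → 2 ≤ length (ys ∖ xs)
2≤length-∖ {xs} {ys} unique-xs unique-ys balanced xs≉ys
  with balanced-disjoint⇒[]⊎2≤length (∖-balanced unique-xs unique-ys balanced) (∖-disjoint xs ys)
... | inj₁ (xs∖ys≡[] , ys∖xs≡[]) = ⊥-elim (xs≉ys λ _ → mk⇔ (∖≡[]⇒⊆ xs∖ys≡[]) (∖≡[]⇒⊆ ys∖xs≡[]))
... | inj₂ 2≤length = 2≤length

infixl 6 _∪_

_∪_ : List ℤ → List ℤ → List ℤ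
xs ∪ ys = xs ++ ys ∖ xs

∪-unique : ∀ {xs ys} → Unique xs → Unique ys → Unique (xs ∪ ys)
∪-unique {xs} {ys} unique-xs unique-ys =
  UniqueP.++⁺ unique-xs (UniqueP.filter⁺ (∁? (_∈? xs)) unique-ys)
    (λ (z∈xs , z∈ys∖xs) → proj₂ (∈-∖⁻ ys xs z∈ys∖xs) z∈xs)

∈-∪⁻ : ∀ {z} xs ys → z ∈ xs ∪ ys → z ∈ xs ⊎ z ∈ ys
∈-∪⁻ xs ys z∈ = Sum.map₂ (λ z∈ys∖xs → proj₁ (∈-∖⁻ ys xs z∈ys∖xs)) (∈-++⁻ xs z∈)

-- Only the two representations supplied by InT are used.
lemma3 : (n : ℕ) (A : List ℤ) → Unique A → length A ≡ n →
    (k : ℕ) → k < n →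
    (t : ℤ) → InWedge (k + 1) A t → InT k A t →
    DegreeAtLeast (k + 3) k A t
lemma3 _ _ _ _ k _ t _
  (xs , ys , rep-xs@((len-xs , unique-xs , _) , sum-xs) , rep-ys@((len-ys , unique-ys , _) , sum-ys) , xs≉ys) =
  neighbours⇒DegreeAtLeast k+3≤length
    (UniqueP.map⁺ (-‿cancelˡ t) (∪-unique unique-xs unique-ys))
    (AllP.map⁺ (All.tabulate λ z∈ → [ Rep⇒Neighbour rep-xs , Rep⇒Neighbour rep-ys ]′ (∈-∪⁻ xs ys z∈)))
  where
  open ℕP.≤-Reasoning
  balanced : Balanced xs ys
  balanced = trans len-xs (sym len-ys) , trans sum-xs (sym sum-ys)
  k+3≤length : k + 3 ≤ length (map (λ a → t - a) (xs ∪ ys))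
  k+3≤length = begin
    k + 3                         ≡⟨ ℕP.+-suc k 2 ⟩
    suc k + 2                     ≤⟨ ℕP.+-monoʳ-≤ (suc k) (2≤length-∖ unique-xs unique-ys balanced xs≉ys) ⟩
    suc k + length (ys ∖ xs)      ≡⟨ cong (_+ length (ys ∖ xs)) len-xs ⟨
    length xs + length (ys ∖ xs)  ≡⟨ LP.length-++ xs ⟨
    length (xs ∪ ys)              ≡⟨ LP.length-map (λ a → t - a) (xs ∪ ys) ⟨
    length (map (λ a → t - a) (xs ∪ ys)) ∎
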